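{- The trace logic with formulas $\phi::=0\mid\mathrm{tick}\mid\phi\vee\phi\mid\langle a\rangle\phi$ ($a\in\mathit{Act}$), axiomatised by the join-semilattice laws for $0,\vee$ together with $\langle a\rangle 0=0$ and $\langle a\rangle(\phi\vee\psi)=\langle a\rangle\phi\vee\langle a\rangle\psi$, is expressive and complete with respect to coalgebras $\gamma:X\to\mathcal{P}_\omega(\{*\}+\mathit{Act}\times X)$ and trace semantics. Expressive: any two states that are not trace equivalent are distinguished by some formula. Complete: if an equation $\phi=\psi$ is not derivable, then there is a coalgebra and a state $x$ with $x\Vdash\phi$ and $x\not\Vdash\psi$ (or vice versa).
   Context: A coalgebra $\gamma:X\to\mathcal{P}_\omega(\{*\}+\mathit{Act}\times X)$ is a finitely branching nondeterministic automaton: $(a,x')\in\gamma(x)$ means $x$ can input $a$ and move to $x'$, and $*\in\gamma(x)$ means $x$ is accepting. Two states are trace equivalent iff they accept the same set of finite words over $\mathit{Act}$. Semantics: $x\not\Vdash 0$; $x\Vdash\mathrm{tick}$ iff $*\in\gamma(x)$; $x\Vdash\phi\vee\psi$ iff $x\Vdash\phi$ or $x\Vdash\psi$; $x\Vdash\langle a\rangle\phi$ iff there is $x'$ with $(a,x')\in\gamma(x)$ and $x'\Vdash\phi$. Categorically, this is the logic $(L,\delta)$ on join-semilattices ($=$ algebras for the finite powerset monad $\mathcal{P}_\omega$) with $LA\cong F1+\mathit{Act}\cdot A$, $Q=[-,\mathbf{2}]$, $\widetilde{T}A\cong F\{*\}+\mathit{Act}\cdot A$, and $\delta:LQ\to Q\widetilde{T}$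 sending $\mathrm{tick}$ to the map that is the isomorphism $F\{*\}\cong\mathbf{2}$ on the first summand and $0$ elsewhere, and $\langle a\rangle\phi$ to the map that is $\phi$ on the $a$-th copy of $A$ and $0$ elsewhere; $\delta$ is an isomorphism on finite semilattices. -}

module Defs where

open import Data.Unit using (⊤; tt)
open import Data.Sum using (_⊎_; inj₁; inj₂)
open import Data.Product using (_×_; _,_; ∃; Σ)
open import Data.List using (List; []; _∷_)
open import Data.List.Membership.Propositional using (_∈_)
open import Data.Empty using (⊥)
open import Function.Bundles using (_⇔_)

data Form (Act : Set) : Set where
  ff   : Form Act
  tick : Form Act
  _∨_  : Form Act → Form Act → Form Act
  ⟨_⟩_ : Act → Form Act → Form Act

-- Finitely branching coalgebra X → P_ω({*} + Act × X); finite subsets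
-- represented by lists (order/duplicates irrelevant: only membership is used).
-- inj₁ tt plays the role of *.
Coalg : (Act X : Set) → Set
Coalg Act X = X → List (⊤ ⊎ (Act × X))

Sat : {Act X : Set} → Coalg Act X → X → Form Act → Set
Sat γ x ff = ⊥
Sat γ x tick = inj₁ tt ∈ γ x
Sat γ x (φ ∨ ψ) = Sat γ x φ ⊎ Sat γ x ψ
Sat {Act} {X} γ x (⟨ a ⟩ φ) = Σ X λ x' → (inj₂ (a , x') ∈ γ x) × Sat γ x' φ

Accepts : {Act X : Set} → Coalg Act X → X → List Act → Set
Accepts γ x [] = inj₁ tt ∈ γ x
Accepts {Act} {X} γ x (a ∷ w) = Σ X λ x' → (inj₂ (a , x') ∈ γ x) × Accepts γ x' w

TraceEquiv : {Act X : Set} → Coalg Act X → X → X → Set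
TraceEquiv γ x y = ∀ w → Accepts γ x w ⇔ Accepts γ y w

infix 4 _⊢_≈_
data _⊢_≈_ (Act : Set) : Form Act → Form Act → Set where
  refl′  : ∀ {φ} → Act ⊢ φ ≈ φ
  sym′   : ∀ {φ ψ} → Act ⊢ φ ≈ ψ → Act ⊢ ψ ≈ φ
  trans′ : ∀ {φ ψ χ} → Act ⊢ φ ≈ ψ → Act ⊢ ψ ≈ χ → Act ⊢ φ ≈ χ
  ∨-cong : ∀ {φ φ' ψ ψ'} → Act ⊢ φ ≈ φ' → Act ⊢ ψ ≈ ψ' → Act ⊢ (φ ∨ ψ) ≈ (φ' ∨ ψ')
  ◇-cong : ∀ {a φ ψ} → Act ⊢ φ ≈ ψ → Act ⊢ (⟨ a ⟩ φ) ≈ (⟨ a ⟩ ψ)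
  ∨-assoc : ∀ {φ ψ χ} → Act ⊢ ((φ ∨ ψ) ∨ χ) ≈ (φ ∨ (ψ ∨ χ))
  ∨-comm  : ∀ {φ ψ} → Act ⊢ (φ ∨ ψ) ≈ (ψ ∨ φ)
  ∨-idem  : ∀ {φ} → Act ⊢ (φ ∨ φ) ≈ φ
  ∨-unit  : ∀ {φ} → Act ⊢ (φ ∨ ff) ≈ φ
  ◇-ff    : ∀ {a} → Act ⊢ (⟨ a ⟩ ff) ≈ ff
  ◇-∨     : ∀ {a φ ψ} → Act ⊢ (⟨ a ⟩ (φ ∨ ψ)) ≈ ((⟨ a ⟩ φ) ∨ (⟨ a ⟩ ψ))

-- Every formula is provably the finite join of the word formulas ⟨a₁⟩…⟨aₙ⟩tick
-- for the words in its language, and a word formula holds at a state exactly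
-- when the state accepts that word; this gives expressivity. On the
-- automaton whose states are words and whose state w accepts w alone, a
-- formula holds at w iff w is in its language, so semantically equivalent
-- formulas have equal languages and hence provably equal normal forms.
module Submission where

open import Defs
open import Data.List using (List; []; _∷_; _++_; map)
open import Data.List.Membership.Propositional using (_∈_)
open import Data.List.Membership.Propositional.Properties
  using (∈-++⁺ˡ; ∈-++⁺ʳ; ∈-++⁻; ∈-map⁺; ∈-map⁻)
open import Data.List.Relation.Binary.Subset.Propositional using (_⊆_)
open import Data.List.Relation.Unary.Any using (here; there)
open import Data.Product using (_×_; _,_)
open import Data.Sum using (inj₁; inj₂)
open import Data.Unit using (tt)
open import Function.Base using (_∘′_)
open import Function.Bundles using (_⇔_; mk⇔; Equivalence)
open import Level using (0ℓ)
open import Relation.Binary.Bundles using (Setoid)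
open import Relation.Binary.PropositionalEquality using (refl)
import Relation.Binary.Reasoning.Setoid as SetoidReasoning

module _ {Act : Set} where

  ⊢≈-setoid : Setoid 0ℓ 0ℓ
  ⊢≈-setoid = record
    { Carrier       = Form Act
    ; _≈_           = Act ⊢_≈_
    ; isEquivalence = record { refl = refl′ ; sym = sym′ ; trans = trans′ }
    }

  open SetoidReasoning ⊢≈-setoid

  wordForm : List Act → Form Act
  wordForm []      = tick
  wordForm (a ∷ w) = ⟨ a ⟩ wordForm w

  Sat-wordForm⇔Accepts : {X : Set} (γ : Coalg Act X) (x : X) (w : List Act) →
                         Sat γ x (wordForm w) ⇔ Accepts γ x w
  Sat-wordForm⇔Accepts γ x w = mk⇔ (to x w) (from x w)
    where
    to : ∀ x w → Sat γ x (wordForm w) → Accepts γ x w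
    to x []      s             = s
    to x (a ∷ w) (x' , m , s)  = x' , m , to x' w s
    from : ∀ x w → Accepts γ x w → Sat γ x (wordForm w)
    from x []      s            = s
    from x (a ∷ w) (x' , m , s) = x' , m , from x' w s

  ⋁ : List (List Act) → Form Act
  ⋁ []      = ff
  ⋁ (w ∷ L) = wordForm w ∨ ⋁ L

  language : Form Act → List (List Act)
  language ff        = []
  language tick      = [] ∷ []
  language (φ ∨ ψ)   = language φ ++ language ψ
  language (⟨ a ⟩ φ) = map (a ∷_) (language φ)

  ⋁-++ : ∀ L M → Act ⊢ ⋁ (L ++ M) ≈ (⋁ L ∨ ⋁ M)
  ⋁-++ []      M = sym′ (trans′ ∨-comm ∨-unit)
  ⋁-++ (w ∷ L) M = trans′ (∨-cong refl′ (⋁-++ L M)) (sym′ ∨-assoc)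

  ◇-⋁ : ∀ a L → Act ⊢ (⟨ a ⟩ ⋁ L) ≈ ⋁ (map (a ∷_) L)
  ◇-⋁ a []      = ◇-ff
  ◇-⋁ a (w ∷ L) = trans′ ◇-∨ (∨-cong refl′ (◇-⋁ a L))

  ≈-⋁-language : ∀ φ → Act ⊢ φ ≈ ⋁ (language φ)
  ≈-⋁-language ff        = refl′
  ≈-⋁-language tick      = sym′ ∨-unit
  ≈-⋁-language (φ ∨ ψ)   = trans′ (∨-cong (≈-⋁-language φ) (≈-⋁-language ψ))
                                  (sym′ (⋁-++ (language φ) (language ψ)))
  ≈-⋁-language (⟨ a ⟩ φ) = trans′ (◇-cong (≈-⋁-language φ)) (◇-⋁ a (language φ))

  ⋁-absorb : ∀ {w} L → w ∈ L → Act ⊢ (wordForm w ∨ ⋁ L) ≈ ⋁ L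
  ⋁-absorb {w} (w ∷ L) (here refl) = begin
    wordForm w ∨ (wordForm w ∨ ⋁ L)  ≈⟨ ∨-assoc ⟨
    (wordForm w ∨ wordForm w) ∨ ⋁ L  ≈⟨ ∨-cong ∨-idem refl′ ⟩
    wordForm w ∨ ⋁ L                 ∎
  ⋁-absorb {w} (v ∷ L) (there w∈L) = begin
    wordForm w ∨ (wordForm v ∨ ⋁ L)  ≈⟨ ∨-assoc ⟨
    (wordForm w ∨ wordForm v) ∨ ⋁ L  ≈⟨ ∨-cong ∨-comm refl′ ⟩
    (wordForm v ∨ wordForm w) ∨ ⋁ L  ≈⟨ ∨-assoc ⟩
    wordForm v ∨ (wordForm w ∨ ⋁ L)  ≈⟨ ∨-cong refl′ (⋁-absorb L w∈L) ⟩
    wordForm v ∨ ⋁ L                 ∎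

  ⋁-absorb-⊆ : ∀ L M → L ⊆ M → Act ⊢ (⋁ L ∨ ⋁ M) ≈ ⋁ M
  ⋁-absorb-⊆ []      M L⊆M = trans′ ∨-comm ∨-unit
  ⋁-absorb-⊆ (w ∷ L) M L⊆M = begin
    (wordForm w ∨ ⋁ L) ∨ ⋁ M  ≈⟨ ∨-assoc ⟩
    wordForm w ∨ (⋁ L ∨ ⋁ M)  ≈⟨ ∨-cong refl′ (⋁-absorb-⊆ L M (λ w∈L → L⊆M (there w∈L))) ⟩
    wordForm w ∨ ⋁ M          ≈⟨ ⋁-absorb M (L⊆M (here refl)) ⟩
    ⋁ M                       ∎

  ⋁-cong-⊆⊇ : ∀ L M → L ⊆ M → M ⊆ L → Act ⊢ ⋁ L ≈ ⋁ M
  ⋁-cong-⊆⊇ L M L⊆M M⊆L = begin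
    ⋁ L        ≈⟨ ⋁-absorb-⊆ M L M⊆L ⟨
    ⋁ M ∨ ⋁ L  ≈⟨ ∨-comm ⟩
    ⋁ L ∨ ⋁ M  ≈⟨ ⋁-absorb-⊆ L M L⊆M ⟩
    ⋁ M        ∎

  wordAutomaton : Coalg Act (List Act)
  wordAutomaton []      = inj₁ tt ∷ []
  wordAutomaton (a ∷ w) = inj₂ (a , w) ∷ []

  Sat-wordAutomaton⇔∈language : ∀ φ w → Sat wordAutomaton w φ ⇔ w ∈ language φ
  Sat-wordAutomaton⇔∈language φ w = mk⇔ (to φ w) (from φ w)
    where
    to : ∀ φ w → Sat wordAutomaton w φ → w ∈ language φ
    to tick      []      _                   = here refl
    to tick      (a ∷ w) (here ())
    to tick      (a ∷ w) (there ())
    to (φ ∨ ψ)   w       (inj₁ s)            = ∈-++⁺ˡ (to φ w s)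
    to (φ ∨ ψ)   w       (inj₂ s)            = ∈-++⁺ʳ (language φ) (to ψ w s)
    to (⟨ a ⟩ φ) []      (_ , here () , _)
    to (⟨ a ⟩ φ) []      (_ , there () , _)
    to (⟨ a ⟩ φ) (b ∷ w) (_ , here refl , s) = ∈-map⁺ (a ∷_) (to φ w s)
    to (⟨ a ⟩ φ) (b ∷ w) (_ , there () , _)
    from : ∀ φ w → w ∈ language φ → Sat wordAutomaton w φ
    from tick      []      _ = here refl
    from tick      (a ∷ w) (here ())
    from tick      (a ∷ w) (there ())
    from (φ ∨ ψ)   w       w∈ with ∈-++⁻ (language φ) w∈
    ... | inj₁ w∈φ = inj₁ (from φ w w∈φ)
    ... | inj₂ w∈ψ = inj₂ (from ψ w w∈ψ)
    from (⟨ a ⟩ φ) w       w∈ with ∈-map⁻ (a ∷_) w∈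
    ... | v , v∈φ , refl = v , here refl , from φ v v∈φ

mainTheorem5 : (Act : Set) →
    ((X : Set) (γ : Coalg Act X) (x y : X) →
    (∀ φ → Sat γ x φ ⇔ Sat γ y φ) → TraceEquiv γ x y)
    ×
    ((φ ψ : Form Act) →
    ((X : Set) (γ : Coalg Act X) (x : X) → Sat γ x φ ⇔ Sat γ x ψ) →
    Act ⊢ φ ≈ ψ)
mainTheorem5 Act = expressive , complete
  where
  open Equivalence

  expressive : (X : Set) (γ : Coalg Act X) (x y : X) →
               (∀ φ → Sat γ x φ ⇔ Sat γ y φ) → TraceEquiv γ x y
  expressive X γ x y x≡y w = mk⇔
    (λ acc → to (accepts y) (to (x≡y (wordForm w)) (from (accepts x) acc)))
    (λ acc → to (accepts x) (from (x≡y (wordForm w)) (from (accepts y) acc)))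
    where accepts = λ z → Sat-wordForm⇔Accepts γ z w

  complete : (φ ψ : Form Act) →
             ((X : Set) (γ : Coalg Act X) (x : X) → Sat γ x φ ⇔ Sat γ x ψ) →
             Act ⊢ φ ≈ ψ
  complete φ ψ valid = begin
    φ                ≈⟨ ≈-⋁-language φ ⟩
    ⋁ (language φ)   ≈⟨ ⋁-cong-⊆⊇ (language φ) (language ψ) φ⊆ψ ψ⊆φ ⟩
    ⋁ (language ψ)   ≈⟨ ≈-⋁-language ψ ⟨
    ψ                ∎
    where
    open SetoidReasoning (⊢≈-setoid {Act})
    inLanguage = Sat-wordAutomaton⇔∈language
    φ⊆ψ : language φ ⊆ language ψ
    φ⊆ψ {w} = to (inLanguage ψ w) ∘′ to (valid _ wordAutomaton w) ∘′ from (inLanguage φ w)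
    ψ⊆φ : language ψ ⊆ language φ
    ψ⊆φ {w} = to (inLanguage φ w) ∘′ from (valid _ wordAutomaton w) ∘′ from (inLanguage ψ w)
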